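{- Let $q$ be an odd prime, and suppose $k, y$ are positive integers with \[ (2^{k}-1)(3^{k}-1)=y^{q}. \] Let $p \ge 11$ be a prime such that $(p-1)\mid k$. Then \[ \nu_{p}(k)>\frac{1}{2}\left(q- \frac{\log 6}{\log p}\cdot (p-1)\right). \] In particular, if moreover $p\le q$, then $p \mid k$.
   Context: For a prime $p$ and a nonzero integer $n$, $\nu_p(n)$ denotes the $p$-adic valuation of $n$, i.e. the exponent of $p$ in the prime factorization of $n$. $\log$ is the natural logarithm. -}

module Defs where

open import Data.Nat using (ℕ; suc; _^_)
open import Data.Nat.Divisibility using (_∣_)
open import Data.Product using (_×_)
open import Relation.Nullary using (¬_)

-- p-adic valuation as a relation: ν_p(n) = v  iff  p^v ∣ n and p^(v+1) ∤ n.
-- (For n ≠ 0 and p prime this determines v uniquely.)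
IsPadicVal : ℕ → ℕ → ℕ → Set
IsPadicVal p n v = (p ^ v ∣ n) × ¬ (p ^ suc v ∣ n)

{-# OPTIONS --safe #-}
-- Write k = (p − 1)·w·p^v with v = ν_p(k) and p ∤ w. By Fermat, p divides
-- A = 2^(p−1) − 1 and B = 3^(p−1) − 1, and lifting the exponent (p is odd) gives
-- 2^k − 1 = A·p^v·U and 3^k − 1 = B·p^v·U′ with p ∤ U·U′. Hence p ∣ y, and
-- p^q ∣ y^q = A·B·p^(2v)·U·U′ forces p^(q − 2v) ≤ A·B < 6^(p−1). If p ∤ k, then
-- v = 0 and p^q < 6^(p−1) ≤ p^(p−1), so q < p.

module Submission where

open import Defs
open import Data.Nat using (ℕ; _+_; _*_; _∸_; _^_; _≤_; _<_)
open import Data.Nat.Divisibility using (_∣_)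
open import Data.Nat.Primality using (Prime)
open import Data.Product using (_×_)
open import Relation.Binary.PropositionalEquality using (_≡_; _≢_)

open import Data.Empty using (⊥-elim)
open import Data.Fin.Base as Fin using (Fin; toℕ; fromℕ)
open import Data.Fin.Properties using (toℕ-fromℕ; toℕ-inject₁; toℕ<n)
open import Data.Nat.Base using (zero; suc; NonZero; >-nonZero; _!; z≤n; s≤s; z<s; s<s)
open import Data.Nat.Combinatorics
  using (_C_; nCk≡n!/k![n-k]!; k![n∸k]!∣n!; nCn≡1; nC1≡n; nCk+nC[k+1]≡[n+1]C[k+1])
open import Data.Nat.Divisibility
open import Data.Nat.Primality using (euclidsLemma; ¬prime[0]; ¬prime[1]; prime⇒nonZero)
open import Data.Nat.Properties
open import Data.Nat.Tactic.RingSolver using (solve-∀)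
open import Data.Product using (∃; _,_)
open import Data.Sum using (inj₁; inj₂)
open import Data.Vec.Functional using (Vector; tail; init; last)
open import Function.Base using (_∘_)
open import Relation.Binary.PropositionalEquality
  using (refl; sym; trans; cong; cong₂; subst; module ≡-Reasoning)
open import Relation.Nullary using (yes; no)

open import Algebra.Properties.CommutativeSemiring.Binomial +-*-commutativeSemiring as Binomial
  using (binomialExpansion; binomialTerm)
open import Algebra.Properties.CommutativeSemiring.Exp +-*-commutativeSemiring using (^-distrib-*)
open import Algebra.Properties.Monoid.Sum +-0-monoid using (sum; sum-cong-≗; sum-init-last)
import Algebra.Properties.Semiring.Exp +-*-semiring as SemiringExp
import Algebra.Properties.Semiring.Mult +-*-semiring as SemiringMult

prime∤1 : ∀ {p} → Prime p → p ∤ 1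
prime∤1 pp p∣1 with ∣1⇒≡1 p∣1
... | refl = ¬prime[1] pp

∣m*n∤m⇒∣n : ∀ {p m n} → Prime p → p ∣ m * n → p ∤ m → p ∣ n
∣m*n∤m⇒∣n {m = m} {n} pp p∣m*n p∤m with euclidsLemma m n pp p∣m*n
... | inj₁ p∣m = ⊥-elim (p∤m p∣m)
... | inj₂ p∣n = p∣n

prime∤* : ∀ {p m n} → Prime p → p ∤ m → p ∤ n → p ∤ m * n
prime∤* pp p∤m p∤n p∣m*n = p∤n (∣m*n∤m⇒∣n pp p∣m*n p∤m)

∤m∣n⇒∤m+n : ∀ {d m n} → d ∤ m → d ∣ n → d ∤ m + n
∤m∣n⇒∤m+n {d} {m} {n} d∤m d∣n d∣m+n = d∤m (∣m+n∣m⇒∣n (subst (d ∣_) (+-comm m n) d∣m+n) d∣n)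

prime∣^⇒∣ : ∀ {p m} → Prime p → ∀ n → p ∣ m ^ n → p ∣ m
prime∣^⇒∣ pp zero    p∣1 = ⊥-elim (prime∤1 pp p∣1)
prime∣^⇒∣ {m = m} pp (suc n) p∣m^[1+n] with euclidsLemma m (m ^ n) pp p∣m^[1+n]
... | inj₁ p∣m   = p∣m
... | inj₂ p∣m^n = prime∣^⇒∣ pp n p∣m^n

^-monoˡ-∣ : ∀ {d m} n → d ∣ m → d ^ n ∣ m ^ n
^-monoˡ-∣ zero    d∣m = ∣-refl
^-monoˡ-∣ (suc n) d∣m = *-pres-∣ d∣m (^-monoˡ-∣ n d∣m)

prime^∣*⇒∣ : ∀ {p m} → Prime p → p ∤ m → ∀ v n → p ^ v ∣ m * n → p ^ v ∣ n
prime^∣*⇒∣ pp p∤m zero    n _ = 1∣ n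
prime^∣*⇒∣ {p} {m} pp p∤m (suc v) n p^[1+v]∣m*n
  with ∣m*n∤m⇒∣n pp (m*n∣⇒m∣ p (p ^ v) p^[1+v]∣m*n) p∤m
... | divides n′ refl =
  subst (p * p ^ v ∣_) (*-comm p n′) (*-monoʳ-∣ p (prime^∣*⇒∣ pp p∤m v n′ p^v∣m*n′))
  where
  instance _ = prime⇒nonZero pp
  swap : ∀ m n′ p → m * (n′ * p) ≡ p * (m * n′)
  swap = solve-∀
  p^v∣m*n′ : p ^ v ∣ m * n′
  p^v∣m*n′ = *-cancelˡ-∣ p (subst (p * p ^ v ∣_) (swap m n′ p) p^[1+v]∣m*n)

^∣^*⇒^∸∣ : ∀ m .{{_ : NonZero m}} n o {k} → m ^ n ∣ m ^ o * k → m ^ (n ∸ o) ∣ k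
^∣^*⇒^∸∣ m n o {k} m^n∣m^o*k with o ≤? n
... | yes o≤n = *-cancelˡ-∣ (m ^ o) {{m^n≢0 m o}} (subst (_∣ m ^ o * k) split m^n∣m^o*k)
  where
  split : m ^ n ≡ m ^ o * m ^ (n ∸ o)
  split = trans (cong (m ^_) (sym (m+[n∸m]≡n o≤n))) (^-distribˡ-+-* m o (n ∸ o))
... | no o≰n = subst (λ e → m ^ e ∣ k) (sym (m≤n⇒m∸n≡0 (<⇒≤ (≰⇒> o≰n)))) (1∣ k)

n∣n! : ∀ n .{{_ : NonZero n}} → n ∣ n !
n∣n! (suc n) = m∣m*n (n !)

prime∣!⇒≤ : ∀ {p} → Prime p → ∀ m → p ∣ m ! → p ≤ m
prime∣!⇒≤ pp zero    p∣1 = ⊥-elim (prime∤1 pp p∣1)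
prime∣!⇒≤ pp (suc m) p∣[1+m]! with euclidsLemma (suc m) (m !) pp p∣[1+m]!
... | inj₁ p∣1+m = ∣⇒≤ p∣1+m
... | inj₂ p∣m!  = m≤n⇒m≤1+n (prime∣!⇒≤ pp m p∣m!)

k!*[n∸k]!*nCk≡n! : ∀ {n k} → k ≤ n → k ! * (n ∸ k) ! * (n C k) ≡ n !
k!*[n∸k]!*nCk≡n! {n} {k} k≤n = begin
  k ! * (n ∸ k) ! * (n C k)     ≡⟨ cong (k ! * (n ∸ k) ! *_) (trans (nCk≡n!/k![n-k]! k≤n) (n/m≡quotient d)) ⟩
  k ! * (n ∸ k) ! * quotient d  ≡⟨ sym (m∣n⇒n≡m*quotient d) ⟩
  n !                           ∎
  where
  open ≡-Reasoning
  instance _ = k !* (n ∸ k) !≢0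
  d = k![n∸k]!∣n! k≤n

prime∣pCk : ∀ {p k} → Prime p → 0 < k → k < p → p ∣ p C k
prime∣pCk {p} {k} pp 0<k k<p = ∣m*n∤m⇒∣n pp p∣k!*[p∸k]!*pCk
  (prime∤* pp (p∤m! k k<p) (p∤m! (p ∸ k) (∸-monoʳ-< 0<k (<⇒≤ k<p))))
  where
  p∣k!*[p∸k]!*pCk : p ∣ k ! * (p ∸ k) ! * (p C k)
  p∣k!*[p∸k]!*pCk = subst (p ∣_) (sym (k!*[n∸k]!*nCk≡n! (<⇒≤ k<p))) (n∣n! p {{prime⇒nonZero pp}})
  p∤m! : ∀ m → m < p → p ∤ m !
  p∤m! m m<p p∣m! = <⇒≱ m<p (prime∣!⇒≤ pp m p∣m!)

∣-sum : ∀ {d n} (f : Vector ℕ n) → (∀ i → d ∣ f i) → d ∣ sum f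
∣-sum {n = zero}  f d∣f = _ ∣0
∣-sum {n = suc n} f d∣f = ∣m∣n⇒∣m+n (d∣f Fin.zero) (∣-sum (tail f) (d∣f ∘ Fin.suc))

^-agrees : ∀ x n → x SemiringExp.^ n ≡ x ^ n
^-agrees x zero    = refl
^-agrees x (suc n) = cong (x *_) (^-agrees x n)

×-agrees : ∀ n x → n SemiringMult.× x ≡ n * x
×-agrees zero    x = refl
×-agrees (suc n) x = cong (x +_) (×-agrees n x)

binomial-theorem : ∀ n x → (x + 1) ^ n ≡ sum (λ (k : Fin (suc n)) → (n C toℕ k) * x ^ toℕ k)
binomial-theorem n x = begin
  (x + 1) ^ n                                    ≡⟨ sym (^-agrees (x + 1) n) ⟩
  (x + 1) SemiringExp.^ n                        ≡⟨ Binomial.theorem n x 1 ⟩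
  binomialExpansion x 1 n                        ≡⟨ sum-cong-≗ {suc n} term ⟩
  sum {suc n} (λ k → (n C toℕ k) * x ^ toℕ k)   ∎
  where
  open ≡-Reasoning
  term : ∀ k → binomialTerm x 1 n k ≡ (n C toℕ k) * x ^ toℕ k
  term k = begin
    (n C i) SemiringMult.× (x SemiringExp.^ i * 1 SemiringExp.^ (n ∸ i))
      ≡⟨ ×-agrees (n C i) _ ⟩
    (n C i) * (x SemiringExp.^ i * 1 SemiringExp.^ (n ∸ i))
      ≡⟨ cong₂ (λ a b → (n C i) * (a * b)) (^-agrees x i) (trans (^-agrees 1 (n ∸ i)) (^-zeroˡ (n ∸ i))) ⟩
    (n C i) * (x ^ i * 1)
      ≡⟨ cong ((n C i) *_) (*-identityʳ (x ^ i)) ⟩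
    (n C i) * x ^ i ∎
    where i = toℕ k

frobenius : ∀ {p} → Prime p → ∀ x → ∃ λ r → suc x ^ p ≡ x ^ p + 1 + r * p
frobenius {zero}      pp = ⊥-elim (¬prime[0] pp)
frobenius {p@(suc n)} pp x = quotient p∣middle , (begin
  suc x ^ p                                    ≡⟨ cong (_^ p) (+-comm 1 x) ⟩
  (x + 1) ^ p                                  ≡⟨ binomial-theorem p x ⟩
  1 + sum (tail f)                             ≡⟨ cong (1 +_) (sum-init-last (tail f)) ⟩
  1 + (middle + last (tail f))                 ≡⟨ cong₂ (λ s t → 1 + (s + t)) (m∣n⇒n≡quotient*m p∣middle) last-term ⟩
  1 + (quotient p∣middle * p + x ^ p)          ≡⟨ rearrange 1 (quotient p∣middle * p) (x ^ p) ⟩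
  x ^ p + 1 + quotient p∣middle * p            ∎)
  where
  open ≡-Reasoning
  f : Vector ℕ (suc p)
  f k = (p C toℕ k) * x ^ toℕ k
  middle = sum (init (tail f))
  p∣middle : p ∣ middle
  p∣middle = ∣-sum (init (tail f)) λ i →
    ∣m⇒∣m*n _ (prime∣pCk pp z<s (s<s (subst (_< n) (sym (toℕ-inject₁ i)) (toℕ<n i))))
  last-term : last (tail f) ≡ x ^ p
  last-term = begin
    (p C suc (toℕ (fromℕ n))) * x ^ suc (toℕ (fromℕ n)) ≡⟨ cong (λ i → (p C suc i) * x ^ suc i) (toℕ-fromℕ n) ⟩
    (p C p) * x ^ p                                     ≡⟨ cong (_* x ^ p) (nCn≡1 p) ⟩
    1 * x ^ p                                           ≡⟨ *-identityˡ (x ^ p) ⟩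
    x ^ p                                               ∎
  rearrange : ∀ a b c → a + (b + c) ≡ c + a + b
  rearrange = solve-∀

x^p≡x : ∀ {p} → Prime p → ∀ x → ∃ λ r → x ^ p ≡ x + r * p
x^p≡x {zero}      pp = ⊥-elim (¬prime[0] pp)
x^p≡x {p@(suc _)} pp zero    = 0 , refl
x^p≡x {p}         pp (suc x) =
  let r , x^p≡x+r*p         = x^p≡x pp x
      s , [1+x]^p≡x^p+1+s*p = frobenius pp x
  in r + s , (begin
    suc x ^ p              ≡⟨ [1+x]^p≡x^p+1+s*p ⟩
    x ^ p + 1 + s * p      ≡⟨ cong (λ t → t + 1 + s * p) x^p≡x+r*p ⟩
    x + r * p + 1 + s * p  ≡⟨ collect x r s p ⟩
    suc x + (r + s) * p    ∎)
  where
  open ≡-Reasoning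
  collect : ∀ x r s p → x + r * p + 1 + s * p ≡ suc x + (r + s) * p
  collect = solve-∀

fermat : ∀ {p a} → Prime p → p ∤ a → p ∣ a ^ (p ∸ 1) ∸ 1
fermat {zero}          pp = ⊥-elim (¬prime[0] pp)
fermat {p@(suc n)} {a} pp p∤a =
  let r , a^p≡a+r*p = x^p≡x pp a
  in ∣m*n∤m⇒∣n pp (divides r (begin
    a * (a ^ n ∸ 1)  ≡⟨ *-distribˡ-∸ a (a ^ n) 1 ⟩
    a ^ p ∸ a * 1    ≡⟨ cong₂ _∸_ a^p≡a+r*p (*-identityʳ a) ⟩
    a + r * p ∸ a    ≡⟨ m+n∸m≡n a (r * p) ⟩
    r * p            ∎)) p∤a
  where open ≡-Reasoning

binomial-second-order : ∀ d n → ∃ λ r → (1 + d) ^ n ≡ 1 + n * d + (n C 2) * (d * d) + r * (d * d * d)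
binomial-second-order d zero    = 0 , refl
binomial-second-order d (suc n) =
  let r , [1+d]^n≡ = binomial-second-order d n
      r′ = r + (n C 2) + r * d
  in r′ , (begin
    (1 + d) * (1 + d) ^ n
      ≡⟨ cong ((1 + d) *_) [1+d]^n≡ ⟩
    (1 + d) * (1 + n * d + (n C 2) * (d * d) + r * (d * d * d))
      ≡⟨ expand d n (n C 2) r ⟩
    1 + suc n * d + (n + (n C 2)) * (d * d) + r′ * (d * d * d)
      ≡⟨ cong (λ c → 1 + suc n * d + c * (d * d) + r′ * (d * d * d)) pascal ⟩
    1 + suc n * d + (suc n C 2) * (d * d) + r′ * (d * d * d) ∎)
  where
  open ≡-Reasoning
  expand : ∀ d n c r → (1 + d) * (1 + n * d + c * (d * d) + r * (d * d * d))
                     ≡ 1 + suc n * d + (n + c) * (d * d) + (r + c + r * d) * (d * d * d)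
  expand = solve-∀
  pascal : n + (n C 2) ≡ suc n C 2
  pascal = trans (cong (_+ (n C 2)) (sym (nC1≡n n))) (nCk+nC[k+1]≡[n+1]C[k+1] n 1)

binomial-first-order : ∀ d n → ∃ λ r → (1 + d) ^ n ≡ 1 + d * (n + r * d)
binomial-first-order d n =
  let r , [1+d]^n≡ = binomial-second-order d n
  in (n C 2) + r * d , trans [1+d]^n≡ (factor d n (n C 2) r)
  where
  factor : ∀ d n c r → 1 + n * d + c * (d * d) + r * (d * d * d) ≡ 1 + d * (n + (c + r * d) * d)
  factor = solve-∀

-- The term (p C 2) d² is divisible by p d², and not just by d², only because p is odd.
lte-step : ∀ {p d} → Prime p → 2 < p → p ∣ d → ∃ λ u → (1 + d) ^ p ≡ 1 + d * p * u × p ∤ u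
lte-step {p} {d} pp 2<p p∣d@(divides e d≡e*p) =
  let r , [1+d]^p≡      = binomial-second-order d p
      divides c pC2≡c*p = prime∣pCk pp z<s 2<p
  in 1 + d * (c + r * e) , (begin
    (1 + d) ^ p
      ≡⟨ [1+d]^p≡ ⟩
    1 + p * d + (p C 2) * (d * d) + r * (d * d * d)
      ≡⟨ cong₂ (λ a b → 1 + p * d + a * (d * d) + r * (d * d * b)) pC2≡c*p d≡e*p ⟩
    1 + p * d + c * p * (d * d) + r * (d * d * (e * p))
      ≡⟨ factor p d c r e ⟩
    1 + d * p * (1 + d * (c + r * e)) ∎) , ∤m∣n⇒∤m+n (prime∤1 pp) (∣m⇒∣m*n _ p∣d)
  where
  open ≡-Reasoning
  factor : ∀ p d c r e → 1 + p * d + c * p * (d * d) + r * (d * d * (e * p))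
                       ≡ 1 + d * p * (1 + d * (c + r * e))
  factor = solve-∀

lifting-the-exponent : ∀ {p d w} → Prime p → 2 < p → p ∣ d → p ∤ w → ∀ v →
  ∃ λ U → (1 + d) ^ (w * p ^ v) ≡ 1 + d * p ^ v * U × p ∤ U
lifting-the-exponent {p} {d} {w} pp 2<p p∣d p∤w zero =
  let r , [1+d]^w≡ = binomial-first-order d w
  in w + r * d , (begin
    (1 + d) ^ (w * 1)        ≡⟨ cong ((1 + d) ^_) (*-identityʳ w) ⟩
    (1 + d) ^ w              ≡⟨ [1+d]^w≡ ⟩
    1 + d * (w + r * d)      ≡⟨ cong (λ t → 1 + t * (w + r * d)) (sym (*-identityʳ d)) ⟩
    1 + d * 1 * (w + r * d)  ∎) , ∤m∣n⇒∤m+n p∤w (∣n⇒∣m*n r p∣d)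
  where open ≡-Reasoning
lifting-the-exponent {p} {d} {w} pp 2<p p∣d p∤w (suc v) =
  let u , [1+d]^p≡ , p∤u = lte-step pp 2<p p∣d
      U , [1+dpu]^[wp^v]≡ , p∤U =
        lifting-the-exponent pp 2<p (∣m⇒∣m*n u (∣m⇒∣m*n p p∣d)) p∤w v
  in u * U , (begin
    (1 + d) ^ (w * (p * p ^ v))    ≡⟨ cong ((1 + d) ^_) (swap w p (p ^ v)) ⟩
    (1 + d) ^ (p * (w * p ^ v))    ≡⟨ sym (^-*-assoc (1 + d) p (w * p ^ v)) ⟩
    ((1 + d) ^ p) ^ (w * p ^ v)    ≡⟨ cong (_^ (w * p ^ v)) [1+d]^p≡ ⟩
    (1 + d * p * u) ^ (w * p ^ v)  ≡⟨ [1+dpu]^[wp^v]≡ ⟩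
    1 + d * p * u * p ^ v * U      ≡⟨ cong suc (regroup d p u (p ^ v) U) ⟩
    1 + d * (p * p ^ v) * (u * U)  ∎) , prime∤* pp p∤u p∤U
  where
  open ≡-Reasoning
  swap : ∀ w p P → w * (p * P) ≡ p * (w * P)
  swap = solve-∀
  regroup : ∀ d p u P U → d * p * u * P * U ≡ d * (p * P) * (u * U)
  regroup = solve-∀

n∤n∸1 : ∀ {n} → 1 < n → n ∤ n ∸ 1
n∤n∸1 {suc zero}    (s≤s ())
n∤n∸1 {suc (suc n)} _ = >⇒∤ (n<1+n (suc n))

padicVal-split : ∀ {p n k} → Prime p → p ∤ n → n ∣ k → ∀ v → IsPadicVal p k v →
  ∃ λ w → k ≡ n * (w * p ^ v) × p ∤ w
padicVal-split {p} {n} {k} pp p∤n (divides m k≡m*n) v (p^v∣k , p^[1+v]∤k) =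
  w , k≡n*[w*p^v] , p∤w
  where
  p^v∣m : p ^ v ∣ m
  p^v∣m = prime^∣*⇒∣ pp p∤n v m (subst (p ^ v ∣_) (trans k≡m*n (*-comm m n)) p^v∣k)
  w = quotient p^v∣m
  k≡n*[w*p^v] : k ≡ n * (w * p ^ v)
  k≡n*[w*p^v] = trans k≡m*n (trans (*-comm m n) (cong (n *_) (m∣n⇒n≡quotient*m p^v∣m)))
  regroup : ∀ n w′ p P → n * (w′ * p * P) ≡ n * w′ * (p * P)
  regroup = solve-∀
  p∤w : p ∤ w
  p∤w (divides w′ w≡w′*p) = p^[1+v]∤k (divides (n * w′)
    (trans k≡n*[w*p^v] (trans (cong (λ t → n * (t * p ^ v)) w≡w′*p) (regroup n w′ p (p ^ v)))))

fermat-lte : ∀ {p a k} → Prime p → 2 < p → p ∤ a → (p ∸ 1) ∣ k → ∀ v → IsPadicVal p k v →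
  ∃ λ U → a ^ k ∸ 1 ≡ (a ^ (p ∸ 1) ∸ 1) * p ^ v * U × p ∤ U
fermat-lte {p} {zero}      pp 2<p p∤0 = ⊥-elim (p∤0 (p ∣0))
fermat-lte {p} {a@(suc _)} {k} pp 2<p p∤a p∸1∣k v ν =
  let w , k≡[p∸1]*[w*p^v] , p∤w = padicVal-split pp (n∤n∸1 (<-trans (n<1+n 1) 2<p)) p∸1∣k v ν
      U , [1+d]^[w*p^v]≡ , p∤U = lifting-the-exponent pp 2<p (fermat pp p∤a) p∤w v
  in U , cong (_∸ 1) (begin
    a ^ k                        ≡⟨ cong (a ^_) k≡[p∸1]*[w*p^v] ⟩
    a ^ ((p ∸ 1) * (w * p ^ v))  ≡⟨ sym (^-*-assoc a (p ∸ 1) (w * p ^ v)) ⟩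
    (a ^ (p ∸ 1)) ^ (w * p ^ v)  ≡⟨ cong (_^ (w * p ^ v)) (sym (m+[n∸m]≡n (m^n>0 a (p ∸ 1)))) ⟩
    (1 + d) ^ (w * p ^ v)        ≡⟨ [1+d]^[w*p^v]≡ ⟩
    1 + d * p ^ v * U            ∎) , p∤U
  where
  open ≡-Reasoning
  d = a ^ (p ∸ 1) ∸ 1

p^[q∸2v]∣A*B : ∀ {p A B U U′ y} v q → Prime p → p ∤ U → p ∤ U′ → p ∣ A →
  (A * p ^ v * U) * (B * p ^ v * U′) ≡ y ^ q → p ^ (q ∸ 2 * v) ∣ A * B
p^[q∸2v]∣A*B {p} {A} {B} {U} {U′} {y} v q pp p∤U p∤U′ p∣A eq =
  ^∣^*⇒^∸∣ p q (2 * v) (prime^∣*⇒∣ pp (prime∤* pp p∤U p∤U′) q _ p^q∣U*U′*[p^2v*A*B])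
  where
  instance _ = prime⇒nonZero pp
  open ≡-Reasoning
  regroup : ∀ A B U U′ P → (A * P * U) * (B * P * U′) ≡ U * U′ * (P * P * (A * B))
  regroup = solve-∀
  y^q≡ : y ^ q ≡ U * U′ * (p ^ (2 * v) * (A * B))
  y^q≡ = begin
    y ^ q                                ≡⟨ sym eq ⟩
    (A * p ^ v * U) * (B * p ^ v * U′)   ≡⟨ regroup A B U U′ (p ^ v) ⟩
    U * U′ * (p ^ v * p ^ v * (A * B))   ≡⟨ cong (λ t → U * U′ * (t * (A * B))) p^v*p^v≡p^2v ⟩
    U * U′ * (p ^ (2 * v) * (A * B))     ∎
    where
    p^v*p^v≡p^2v : p ^ v * p ^ v ≡ p ^ (2 * v)
    p^v*p^v≡p^2v = sym (trans (cong (λ t → p ^ (v + t)) (+-identityʳ v)) (^-distribˡ-+-* p v v))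
  p∣y : p ∣ y
  p∣y = prime∣^⇒∣ pp q (subst (p ∣_) eq (∣m⇒∣m*n _ (∣m⇒∣m*n U (∣m⇒∣m*n (p ^ v) p∣A))))
  p^q∣U*U′*[p^2v*A*B] : p ^ q ∣ U * U′ * (p ^ (2 * v) * (A * B))
  p^q∣U*U′*[p^2v*A*B] = subst (p ^ q ∣_) y^q≡ (^-monoˡ-∣ q p∣y)

0<a^n∸1 : ∀ {a n} → 1 < a → 0 < n → 0 < a ^ n ∸ 1
0<a^n∸1 {a@(suc _)} {suc n} 1<a _ = m<n⇒0<n∸m (<-≤-trans 1<a (m≤m*n a (a ^ n) {{m^n≢0 a n}}))

[m∸1]*[n∸1]<m*n : ∀ {m n} → 0 < m → 0 < n → (m ∸ 1) * (n ∸ 1) < m * n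
[m∸1]*[n∸1]<m*n {suc m} {suc n} _ _ = *-mono-< (n<1+n m) (n<1+n n)

^-distribʳ-* : ∀ m n o → (m * n) ^ o ≡ m ^ o * n ^ o
^-distribʳ-* m n o = begin
  (m * n) ^ o                          ≡⟨ sym (^-agrees (m * n) o) ⟩
  (m * n) SemiringExp.^ o              ≡⟨ ^-distrib-* m n o ⟩
  m SemiringExp.^ o * n SemiringExp.^ o ≡⟨ cong₂ _*_ (^-agrees m o) (^-agrees n o) ⟩
  m ^ o * n ^ o                        ∎
  where open ≡-Reasoning

p^[q∸2v]<[a*b]^[p∸1] : ∀ {p a b k y} q → Prime p → 2 < p → 1 < a → 1 < b → p ∤ a → p ∤ b →
  (p ∸ 1) ∣ k → (a ^ k ∸ 1) * (b ^ k ∸ 1) ≡ y ^ q →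
  ∀ v → IsPadicVal p k v → p ^ (q ∸ 2 * v) < (a * b) ^ (p ∸ 1)
p^[q∸2v]<[a*b]^[p∸1] {p} {a} {b} q pp 2<p 1<a 1<b p∤a p∤b p∸1∣k eq v ν =
  let U  , a^k∸1≡ , p∤U  = fermat-lte pp 2<p p∤a p∸1∣k v ν
      U′ , b^k∸1≡ , p∤U′ = fermat-lte pp 2<p p∤b p∸1∣k v ν
      p^[q∸2v]∣ = p^[q∸2v]∣A*B v q pp p∤U p∤U′ (fermat pp p∤a)
                        (trans (sym (cong₂ _*_ a^k∸1≡ b^k∸1≡)) eq)
      0<A = 0<a^n∸1 1<a 0<p∸1
      0<B = 0<a^n∸1 1<b 0<p∸1
  in begin-strict
    p ^ (q ∸ 2 * v)                         ≤⟨ ∣⇒≤ {{>-nonZero (*-mono-< 0<A 0<B)}} p^[q∸2v]∣ ⟩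
    (a ^ (p ∸ 1) ∸ 1) * (b ^ (p ∸ 1) ∸ 1)   <⟨ [m∸1]*[n∸1]<m*n (<-≤-trans 0<A (m∸n≤m (a ^ (p ∸ 1)) 1))
                                                                (<-≤-trans 0<B (m∸n≤m (b ^ (p ∸ 1)) 1)) ⟩
    a ^ (p ∸ 1) * b ^ (p ∸ 1)               ≡⟨ sym (^-distribʳ-* a b (p ∸ 1)) ⟩
    (a * b) ^ (p ∸ 1)                       ∎
  where
  open ≤-Reasoning
  0<p∸1 : 0 < p ∸ 1
  0<p∸1 = m<n⇒0<n∸m (<-trans (n<1+n 1) 2<p)

lemma4 : (q k y p : ℕ) → Prime q → q ≢ 2 → 1 ≤ k → 1 ≤ y →
    (2 ^ k ∸ 1) * (3 ^ k ∸ 1) ≡ y ^ q →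
    Prime p → 11 ≤ p → (p ∸ 1) ∣ k →
    (∀ v → IsPadicVal p k v → p ^ (q ∸ 2 * v) < 6 ^ (p ∸ 1))
    × (p ≤ q → p ∣ k)
lemma4 q k y p _ _ _ _ eq pp 11≤p p∸1∣k = bound , p≤q⇒p∣k
  where
  open ≤-Reasoning
  instance _ = prime⇒nonZero pp
  2<p : 2 < p
  2<p = ≤-trans (m≤m+n 3 8) 11≤p
  3<p : 3 < p
  3<p = ≤-trans (m≤m+n 4 7) 11≤p
  bound : ∀ v → IsPadicVal p k v → p ^ (q ∸ 2 * v) < 6 ^ (p ∸ 1)
  bound = p^[q∸2v]<[a*b]^[p∸1] q pp 2<p (n<1+n 1) (s≤s (s≤s z≤n)) (>⇒∤ 2<p) (>⇒∤ 3<p) p∸1∣k eq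
  p≤q⇒p∣k : p ≤ q → p ∣ k
  p≤q⇒p∣k p≤q with p ∣? k
  ... | yes p∣k = p∣k
  ... | no  p∤k = ⊥-elim (<⇒≱ (bound 0 (1∣ k , p∤k ∘ subst (_∣ k) (*-identityʳ p))) (begin
      6 ^ (p ∸ 1)  ≤⟨ ^-monoˡ-≤ (p ∸ 1) (≤-trans (m≤m+n 6 5) 11≤p) ⟩
      p ^ (p ∸ 1)  ≤⟨ ^-monoʳ-≤ p (≤-trans (m∸n≤m p 1) p≤q) ⟩
      p ^ q        ∎))
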